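{- Let $M$ be a positive integer. Let $\varepsilon(M)$ be the greatest common divisor of the integers $a-d$ over all matrices $\begin{pmatrix}a&b\\c&d\end{pmatrix}\in\Gamma_0(M)$, and let $e(M)$ be the greatest common divisor of $a-d$ over all matrices $\begin{pmatrix}a&b\\c&d\end{pmatrix}\in G_0(M)\cap M_2(\mathbb{Z})$. Then $\varepsilon(M) = \gcd(M,24)$ and $e(M) = \gcd(M,2)$. Consequently $\Gamma_0(M) = \Gamma_0^{(M')}(M)$ with $M' = \gcd(M,24)$.
   Context: $\Gamma_0(M)$ is the group of matrices in $\mathrm{SL}_2(\mathbb{Z})$ with lower-left entry divisible by $M$. $\mathbb{Z}_{(M)} = \{a/b\in\mathbb{Q}: a,b\in\mathbb{Z},\ \gcd(b,M)=1\}$; $G_0(M)$ is the set of matrices in $M_2(\mathbb{Z}_{(M)})$ with determinant in $\mathbb{Z}_{(M)}^\times$ and lower-left entry in $M\mathbb{Z}_{(M)}$. For a positive divisor $M'$ of $M$, $\Gamma_0^{(M')}(M) = \{\begin{pmatrix}a&b\\c&d\end{pmatrix}\in\Gamma_0(M) : a\equiv d\pmod{M'}\}$. -}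

module Defs where

open import Data.Nat as ℕ using (ℕ)
open import Data.Nat.Coprimality using (Coprime)
open import Data.Integer as ℤ using (ℤ; +_)
open import Data.Integer.Divisibility using (_∣_)
open import Data.Rational as ℚ using (ℚ; ↧ₙ_)
open import Data.Product using (Σ; ∃; _×_)
open import Relation.Binary.PropositionalEquality using (_≡_)

record Mat2 (A : Set) : Set where
  constructor mat
  field
    a b c d : A
open Mat2 public

detℤ : Mat2 ℤ → ℤ
detℤ m = a m ℤ.* d m ℤ.- b m ℤ.* c m

detℚ : Mat2 ℚ → ℚ
detℚ m = a m ℚ.* d m ℚ.- b m ℚ.* c m

InΓ₀ : ℕ → Mat2 ℤ → Set
InΓ₀ M m = (detℤ m ≡ + 1) × ((+ M) ∣ c m)

InΓ₀' : ℕ → ℕ → Mat2 ℤ → Set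
InΓ₀' M' M m = InΓ₀ M m × ((+ M') ∣ (a m ℤ.- d m))

-- ℤ_(M) = { a/b ∈ ℚ : gcd(b, M) = 1 }  (stdlib ℚ is in lowest terms, so
-- this is exactly membership via the reduced denominator)
Inℤ₍_₎ : ℕ → ℚ → Set
Inℤ₍ M ₎ q = Coprime (↧ₙ q) M

Inℤ₍_₎ˣ : ℕ → ℚ → Set
Inℤ₍ M ₎ˣ q = Inℤ₍ M ₎ q × Σ ℚ (λ r → Inℤ₍ M ₎ r × (q ℚ.* r ≡ ℚ.1ℚ))

InG₀ : ℕ → Mat2 ℚ → Set
InG₀ M m =
  Inℤ₍ M ₎ (a m) × Inℤ₍ M ₎ (b m) × Inℤ₍ M ₎ (c m) × Inℤ₍ M ₎ (d m)
  × Inℤ₍ M ₎ˣ (detℚ m)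
  × Σ ℚ (λ x → Inℤ₍ M ₎ x × (c m ≡ ℚ._/_ (+ M) 1 ℚ.* x))

toℚMat : Mat2 ℤ → Mat2 ℚ
toℚMat m = mat (ℚ._/_ (a m) 1) (ℚ._/_ (b m) 1) (ℚ._/_ (c m) 1) (ℚ._/_ (d m) 1)

IsGCDOf : (ℤ → Set) → ℕ → Set
IsGCDOf P g = (∀ x → P x → (+ g) ∣ x) × (∀ e → (∀ x → P x → e ∣ x) → e ∣ (+ g))

TraceDiffΓ₀ : ℕ → ℤ → Set
TraceDiffΓ₀ M x = Σ (Mat2 ℤ) (λ m → InΓ₀ M m × (x ≡ a m ℤ.- d m))

TraceDiffG₀ℤ : ℕ → ℤ → Set
TraceDiffG₀ℤ M x = Σ (Mat2 ℤ) (λ m → InG₀ M (toℚMat m) × (x ≡ a m ℤ.- d m))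

{-# OPTIONS --safe #-}
-- For A = (a b ; c d) in Γ₀(M) with g = gcd(M, 24): M ∣ c gives ad ≡ 1 (mod g), and every unit
-- modulo 24 is its own inverse, so a ≡ d (mod g). Conversely, a common divisor e of all a - d
-- divides M (take (M+1 1 ; M 1)), and completing any a coprime to M to (a y ; M x) in Γ₀(M)
-- gives a ≡ x ≡ a⁻¹, i.e. a² ≡ 1 (mod e). Units modulo M hit every class p mod b with p ∤ b
-- prime, so the choices a ≡ 3 (mod 16), a ≡ 2 (mod 9) and a ≡ 2 (mod b), b prime to 6, rule
-- out 16 ∣ e, 9 ∣ e and other prime factors: e ∣ 24.
-- For integral A in G₀(M) with M even, the determinant is a unit mod 2 and c is even, so a and
-- d are odd; diag(1, -1) and diag(2, 1) lie in G₀(M) and attain the bounds 2 and 1.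
module Submission where

open import Defs
open import Data.Nat as ℕ using (ℕ; _≤_; _<_; NonZero; >-nonZero; ≢-nonZero; ≢-nonZero⁻¹)
import Data.Nat.Properties as ℕ
open import Data.Nat.Divisibility
  using (_∣_; _∣?_; 1∣_; 0∣⇒≡0; ∣-trans; ∣-refl; ∣-antisym; ∣⇒≤; ∣m+n∣m⇒∣n; ∣m⇒∣m*n; n∣m*n;
         quotient≢0; quotient-<; quotient-∣; m∣n⇒n≡quotient*m)
open import Data.Nat.GCD using (gcd; gcd[m,n]∣m; gcd[m,n]∣n; gcd-greatest; module Bézout)
open import Data.Nat.Coprimality as Coprime using (Coprime; coprime-divisor; coprime-Bézout)
open import Data.Nat.Primality
  using (Prime; prime?; prime[2]; prime⇒irreducible; prime⇒nonTrivial; euclidsLemma)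
open import Data.Integer as ℤ using (ℤ; +_; 0ℤ; 1ℤ; _*_; _-_; _+_)
open import Data.Integer.Properties using (pos-+; pos-*; *-comm; *-identityʳ; *-identityˡ; +-identityˡ; abs-*)
import Data.Integer.GCD as ℤ
open import Data.Rational as ℚ using (mkℚ; ↥_; ↧_; toℚᵘ)
import Data.Rational.Properties as ℚ
open import Data.Rational.Unnormalised as ℚᵘ using (mkℚᵘ; *≡*)
import Data.Rational.Unnormalised.Properties as ℚᵘ
open import Data.Integer.Divisibility using () renaming (_∣_ to _∣ᵤ_)
open import Data.Integer.Divisibility.Signed as ℤ∣ using (∣ᵤ⇒∣; ∣⇒∣ᵤ) renaming (_∣_ to _∣ℤ_)
open import Data.Integer.DivMod using (_%ℕ_; _/ℕ_; a≡a%ℕn+[a/ℕn]*n; n%ℕd<d)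
open import Data.Integer.Tactic.RingSolver using (solve-∀)
open import Data.Nat.Induction using (<-rec)
open import Data.Fin using (Fin; toℕ; fromℕ<)
open import Data.Fin.Properties using (all?; toℕ-fromℕ<)
open import Data.Product using (_×_; _,_; proj₁; ∃-syntax)
open import Data.Sum using (_⊎_; inj₁; inj₂)
open import Function.Bundles using (_⇔_; mk⇔)
open import Relation.Nullary using (¬_; yes; no; contradiction)
open import Relation.Nullary.Decidable using (True; toWitness; from-yes; from-no; _→-dec_; _⊎-dec_)
open import Relation.Unary using (Decidable)
open import Relation.Binary.PropositionalEquality

gcd[xy-1,24]∣x-y : ∀ {x y} → x < 24 → y < 24 → gcd (ℤ.∣ + x * + y - 1ℤ ∣) 24 ∣ (ℤ.∣ + x - + y ∣)
gcd[xy-1,24]∣x-y {x} {y} x<24 y<24 =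
  subst₂ Claim (toℕ-fromℕ< x<24) (toℕ-fromℕ< y<24) (on-residues (fromℕ< x<24) (fromℕ< y<24))
  where
  Claim : ℕ → ℕ → Set
  Claim x y = gcd (ℤ.∣ + x * + y - 1ℤ ∣) 24 ∣ (ℤ.∣ + x - + y ∣)
  on-residues : ∀ (i j : Fin 24) → Claim (toℕ i) (toℕ j)
  on-residues = toWitness {a? = all? λ i → all? λ j →
                  gcd (ℤ.∣ + toℕ i * + toℕ j - 1ℤ ∣) 24 ∣? (ℤ.∣ + toℕ i - + toℕ j ∣)} _

∣24∧∣ad-1⇒∣a-d : ∀ {g} a d → g ∣ 24 → (+ g) ∣ℤ (a * d - 1ℤ) → (+ g) ∣ℤ (a - d)
∣24∧∣ad-1⇒∣a-d {g} a d g∣24 g∣ad-1 =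
  subst ((+ g) ∣ℤ_) (sym a-d≡) (ℤ∣.∣m∣n⇒∣m+n g∣x-y (ℤ∣.∣n⇒∣m*n (A - D) g∣24ℤ))
  where
  x y : ℕ
  x = a %ℕ 24
  y = d %ℕ 24
  A D : ℤ
  A = a /ℕ 24
  D = d /ℕ 24
  expand-product : ∀ x y A D n → (x + A * n) * (y + D * n) - 1ℤ ≡ (x * y - 1ℤ) + (A * y + x * D + A * D * n) * n
  expand-product = solve-∀
  expand-difference : ∀ x y A D n → (x + A * n) - (y + D * n) ≡ (x - y) + (A - D) * n
  expand-difference = solve-∀
  g∣24ℤ : (+ g) ∣ℤ (+ 24)
  g∣24ℤ = ∣ᵤ⇒∣ g∣24
  ad-1≡ : a * d - 1ℤ ≡ (+ x * + y - 1ℤ) + (A * + y + + x * D + A * D * + 24) * + 24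
  ad-1≡ = trans (cong₂ (λ u v → u * v - 1ℤ) (a≡a%ℕn+[a/ℕn]*n a 24) (a≡a%ℕn+[a/ℕn]*n d 24))
                (expand-product (+ x) (+ y) A D (+ 24))
  a-d≡ : a - d ≡ (+ x - + y) + (A - D) * + 24
  a-d≡ = trans (cong₂ _-_ (a≡a%ℕn+[a/ℕn]*n a 24) (a≡a%ℕn+[a/ℕn]*n d 24))
               (expand-difference (+ x) (+ y) A D (+ 24))
  g∣xy-1 : (+ g) ∣ℤ (+ x * + y - 1ℤ)
  g∣xy-1 = ℤ∣.∣m+n∣n⇒∣m (subst ((+ g) ∣ℤ_) ad-1≡ g∣ad-1)
                            (ℤ∣.∣n⇒∣m*n (A * + y + + x * D + A * D * + 24) g∣24ℤ)
  g∣x-y : (+ g) ∣ℤ (+ x - + y)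
  g∣x-y = ∣ᵤ⇒∣ (∣-trans (gcd-greatest (∣⇒∣ᵤ g∣xy-1) g∣24) (gcd[xy-1,24]∣x-y (n%ℕd<d a 24) (n%ℕd<d d 24)))

Γ₀⇒gcd[M,24]∣a-d : ∀ {M} m → InΓ₀ M m → (+ gcd M 24) ∣ℤ (a m - d m)
Γ₀⇒gcd[M,24]∣a-d {M} (mat a b c d) (det≡1 , M∣c) =
  ∣24∧∣ad-1⇒∣a-d a d (gcd[m,n]∣n M 24) (subst ((+ gcd M 24) ∣ℤ_) bc≡ad-1 (ℤ∣.∣n⇒∣m*n b g∣c))
  where
  g∣c : (+ gcd M 24) ∣ℤ c
  g∣c = ∣ᵤ⇒∣ (∣-trans (gcd[m,n]∣m M 24) M∣c)
  u-[u-v]≡v : ∀ u v → u - (u - v) ≡ v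
  u-[u-v]≡v = solve-∀
  bc≡ad-1 : b * c ≡ a * d - 1ℤ
  bc≡ad-1 = trans (sym (u-[u-v]≡v (a * d) (b * c))) (cong (a * d -_) det≡1)

prime∤⇒coprime : ∀ {p n} → Prime p → ¬ p ∣ n → Coprime p n
prime∤⇒coprime p-prime p∤n (d∣p , d∣n) with prime⇒irreducible p-prime d∣p
... | inj₁ d≡1 = d≡1
... | inj₂ refl = contradiction d∣n p∤n

coprime-+-* : ∀ {m n} k → Coprime m n → Coprime (m ℕ.+ k ℕ.* n) n
coprime-+-* {m} {n} k m⊥n {d} (d∣m+kn , d∣n) =
  m⊥n (∣m+n∣m⇒∣n (subst (d ∣_) (ℕ.+-comm m (k ℕ.* n)) d∣m+kn) (∣-trans d∣n (n∣m*n k)) , d∣n)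

coprime-* : ∀ {m n o} → Coprime m n → Coprime m o → Coprime m (n ℕ.* o)
coprime-* {m} {n} m⊥n m⊥o {d} (d∣m , d∣no) = m⊥o (d∣m , coprime-divisor d⊥n d∣no)
  where
  d⊥n : Coprime d n
  d⊥n (e∣d , e∣n) = m⊥n (∣-trans e∣d d∣m , e∣n)

-- The class of p modulo b contains a unit modulo M. The side condition ¬ p ∣ y is the
-- induction invariant: when p ∣ M, a solution for M / p is then coprime to p as well.
∃-coprime-p+b*y : ∀ {p b} → Prime p → ¬ p ∣ b →
                  ∀ M → .{{NonZero M}} → ∃[ y ] ¬ p ∣ y × Coprime (p ℕ.+ b ℕ.* y) M
∃-coprime-p+b*y {p} {b} p-prime p∤b M {{M≢0}} = <-rec Goal step M M≢0
  where
  Goal : ℕ → Set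
  Goal M = .(NonZero M) → ∃[ y ] ¬ p ∣ y × Coprime (p ℕ.+ b ℕ.* y) M
  step : ∀ M → (∀ {q} → q < M → Goal q) → Goal M
  step M rec M≢0 with p ∣? M
  ... | no p∤M = M , p∤M , coprime-+-* b (prime∤⇒coprime p-prime p∤M)
  ... | yes p∣M with rec (quotient-< p∣M {{prime⇒nonTrivial p-prime}} {{M≢0}}) (quotient≢0 p∣M {{M≢0}})
  ...   | y , p∤y , p+by⊥q = y , p∤y ,
          subst (Coprime (p ℕ.+ b ℕ.* y)) (sym (m∣n⇒n≡quotient*m p∣M))
            (coprime-* p+by⊥q (Coprime.sym (prime∤⇒coprime p-prime p∤p+by)))
    where
    p∤p+by : ¬ p ∣ p ℕ.+ b ℕ.* y
    p∤p+by p∣p+by with euclidsLemma b y p-prime (∣m+n∣m⇒∣n p∣p+by ∣-refl)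
    ... | inj₁ p∣b = p∤b p∣b
    ... | inj₂ p∣y = p∤y p∣y

divisors-of-24-satisfy : ∀ {P : ℕ → Set} (P? : Decidable P) →
  {True (all? λ (i : Fin 25) → toℕ i ∣? 24 →-dec P? (toℕ i))} → ∀ {q} → q ∣ 24 → P q
divisors-of-24-satisfy {P} P? {all-divisors} {q} q∣24 =
  subst (λ u → u ∣ 24 → P u) (toℕ-fromℕ< q<25) (toWitness all-divisors (fromℕ< q<25)) q∣24
  where
  q<25 : q < 25
  q<25 = ℕ.s≤s (∣⇒≤ q∣24)

PartsDivide8And3 : ℕ → Set
PartsDivide8And3 n = (∀ {b} → b ∣ n → ¬ 3 ∣ b → b ∣ 8) × (∀ {b} → b ∣ n → ¬ 2 ∣ b → b ∣ 3)

PartsDivide8And3-∣ : ∀ {m n} → m ∣ n → PartsDivide8And3 n → PartsDivide8And3 m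
PartsDivide8And3-∣ m∣n (part₂ , part₃) =
  (λ b∣m → part₂ (∣-trans b∣m m∣n)) , (λ b∣m → part₃ (∣-trans b∣m m∣n))

∣24-from-parts : ∀ n → .{{NonZero n}} → PartsDivide8And3 n → n ∣ 24
∣24-from-parts n {{n≢0}} = <-rec Goal step n n≢0
  where
  Goal : ℕ → Set
  Goal n = .(NonZero n) → PartsDivide8And3 n → n ∣ 24
  -- n = q * k with q ∣ 24 by induction; if q * k ∤ 24 then n has the excluded divisor s.
  via-factor : ∀ {n} k s → .{{ℕ.NonTrivial k}} → .(NonZero n) → (∀ {q} → q < n → Goal q) →
               (∀ {q} → q ∣ 24 → q ℕ.* k ∣ 24 ⊎ s ∣ q ℕ.* k) → ¬ s ∣ n → k ∣ n →
               PartsDivide8And3 n → n ∣ 24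
  via-factor k s {{k>1}} n≢0 rec extend s∤n k∣n parts
    with extend (rec (quotient-< k∣n {{k>1}} {{n≢0}}) (quotient≢0 k∣n {{n≢0}})
                     (PartsDivide8And3-∣ (quotient-∣ k∣n) parts))
  ... | inj₁ qk∣24 = subst (_∣ 24) (sym (m∣n⇒n≡quotient*m k∣n)) qk∣24
  ... | inj₂ s∣qk = contradiction (subst (s ∣_) (sym (m∣n⇒n≡quotient*m k∣n)) s∣qk) s∤n
  step : ∀ n → (∀ {q} → q < n → Goal q) → Goal n
  step n rec n≢0 parts@(part₂ , part₃) with 2 ∣? n | 3 ∣? n
  ... | yes 2∣n | _ = via-factor 2 16 n≢0 rec
                        (divisors-of-24-satisfy (λ q → q ℕ.* 2 ∣? 24 ⊎-dec 16 ∣? q ℕ.* 2))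
                        (λ 16∣n → from-no (16 ∣? 8) (part₂ 16∣n (from-no (3 ∣? 16)))) 2∣n parts
  ... | no _ | yes 3∣n = via-factor 3 9 n≢0 rec
                        (divisors-of-24-satisfy (λ q → q ℕ.* 3 ∣? 24 ⊎-dec 9 ∣? q ℕ.* 3))
                        (λ 9∣n → from-no (9 ∣? 3) (part₃ 9∣n (from-no (2 ∣? 9)))) 3∣n parts
  ... | no 2∤n | no _ = ∣-trans (part₃ ∣-refl 2∤n) (∣m⇒∣m*n 8 ∣-refl)

UnitsSquareToOne : ℕ → ℕ → Set
UnitsSquareToOne M n = ∀ a → Coprime a M → (+ n) ∣ℤ (+ a * + a - 1ℤ)

UnitsSquareToOne⇒∣p²-1 : ∀ {M n b p} → .{{NonZero M}} → UnitsSquareToOne M n →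
                          b ∣ n → Prime p → ¬ p ∣ b → (+ b) ∣ℤ (+ p * + p - 1ℤ)
UnitsSquareToOne⇒∣p²-1 {M} {n} {b} {p} squares b∣n p-prime p∤b
  with ∃-coprime-p+b*y p-prime p∤b M
... | y , _ , p+by⊥M = ℤ∣.∣m+n∣n⇒∣m b∣expansion (ℤ∣.∣n⇒∣m*n cofactor ℤ∣.∣-refl)
  where
  cofactor : ℤ
  cofactor = + p * + y + + y * + p + + b * + y * + y
  expand : ∀ p b y → (p + b * y) * (p + b * y) - 1ℤ ≡ (p * p - 1ℤ) + (p * y + y * p + b * y * y) * b
  expand = solve-∀
  p+by : + (p ℕ.+ b ℕ.* y) ≡ + p + + b * + y
  p+by = trans (pos-+ p (b ℕ.* y)) (cong (λ z → + p + z) (pos-* b y))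
  b∣expansion : (+ b) ∣ℤ ((+ p * + p - 1ℤ) + cofactor * + b)
  b∣expansion = subst ((+ b) ∣ℤ_) (trans (cong (λ u → u * u - 1ℤ) p+by) (expand (+ p) (+ b) (+ y)))
                  (ℤ∣.∣-trans (∣ᵤ⇒∣ b∣n) (squares _ p+by⊥M))

UnitsSquareToOne⇒∣24 : ∀ {M n} → .{{NonZero M}} → .{{NonZero n}} → UnitsSquareToOne M n → n ∣ 24
UnitsSquareToOne⇒∣24 squares = ∣24-from-parts _
  ( (λ b∣n 3∤b → ∣⇒∣ᵤ (UnitsSquareToOne⇒∣p²-1 squares b∣n (from-yes (prime? 3)) 3∤b))
  , (λ b∣n 2∤b → ∣⇒∣ᵤ (UnitsSquareToOne⇒∣p²-1 squares b∣n prime[2] 2∤b)) )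

[u+v]-v≡u : ∀ u v → (u + v) - v ≡ u
[u+v]-v≡u = solve-∀

toℤ-u+vw≡st : ∀ u v w s t → u ℕ.+ v ℕ.* w ≡ s ℕ.* t → + u + + v * + w ≡ + s * + t
toℤ-u+vw≡st u v w s t eq = begin
  + u + + v * + w       ≡⟨ cong (λ z → + u + z) (pos-* v w) ⟨
  + u + + (v ℕ.* w)     ≡⟨ pos-+ u (v ℕ.* w) ⟨
  + (u ℕ.+ v ℕ.* w)     ≡⟨ cong +_ eq ⟩
  + (s ℕ.* t)           ≡⟨ pos-* s t ⟩
  + s * + t             ∎
  where open ≡-Reasoning

coprime⇒∃-inverse : ∀ {a M} → Coprime a M → ∃[ x ] ∃[ y ] + a * x - y * + M ≡ 1ℤ
coprime⇒∃-inverse {a} {M} a⊥M with coprime-Bézout a⊥M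
... | Bézout.+- x y 1+yM≡xa = + x , + y , (begin
  + a * + x - + y * + M            ≡⟨ cong (_- + y * + M) (*-comm (+ a) (+ x)) ⟩
  + x * + a - + y * + M            ≡⟨ cong (_- + y * + M) (toℤ-u+vw≡st 1 y M x a 1+yM≡xa) ⟨
  (1ℤ + + y * + M) - + y * + M     ≡⟨ [u+v]-v≡u 1ℤ (+ y * + M) ⟩
  1ℤ                               ∎)
  where open ≡-Reasoning
... | Bézout.-+ x y 1+xa≡yM = ℤ.- + x , ℤ.- + y , (begin
  + a * ℤ.- + x - ℤ.- + y * + M    ≡⟨ swap-signs (+ a) (+ x) (+ y) (+ M) ⟩
  + y * + M - + x * + a            ≡⟨ cong (_- + x * + a) (toℤ-u+vw≡st 1 x a y M 1+xa≡yM) ⟨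
  (1ℤ + + x * + a) - + x * + a     ≡⟨ [u+v]-v≡u 1ℤ (+ x * + a) ⟩
  1ℤ                               ∎)
  where
  open ≡-Reasoning
  swap-signs : ∀ a x y M → a * ℤ.- x - ℤ.- y * M ≡ y * M - x * a
  swap-signs = solve-∀

M∈TraceDiffΓ₀ : ∀ M → TraceDiffΓ₀ M (+ M)
M∈TraceDiffΓ₀ M = mat (+ M + 1ℤ) 1ℤ (+ M) 1ℤ , (det≡1 (+ M) , ∣-refl) , sym ([u+v]-v≡u (+ M) 1ℤ)
  where
  det≡1 : ∀ m → (m + 1ℤ) * 1ℤ - 1ℤ * m ≡ 1ℤ
  det≡1 = solve-∀

TraceDiffΓ₀-divisor⇒UnitsSquareToOne : ∀ {M} e → (∀ x → TraceDiffΓ₀ M x → e ∣ᵤ x) →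
                                       UnitsSquareToOne M ℤ.∣ e ∣
TraceDiffΓ₀-divisor⇒UnitsSquareToOne {M} e e∣trace-diffs a a⊥M with coprime⇒∃-inverse a⊥M
... | x , y , ax-yM≡1 = subst (_ ∣ℤ_) (sym a²-1≡)
      (ℤ∣.∣m∣n⇒∣m+n (ℤ∣.∣n⇒∣m*n (+ a) (divides-trace-diff a-x∈TraceDiffΓ₀))
                    (ℤ∣.∣n⇒∣m*n y (divides-trace-diff (M∈TraceDiffΓ₀ M))))
  where
  divides-trace-diff : ∀ {z} → TraceDiffΓ₀ M z → (+ ℤ.∣ e ∣) ∣ℤ z
  divides-trace-diff z∈ = ∣ᵤ⇒∣ (e∣trace-diffs _ z∈)
  a-x∈TraceDiffΓ₀ : TraceDiffΓ₀ M (+ a - x)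
  a-x∈TraceDiffΓ₀ = mat (+ a) y (+ M) x , (ax-yM≡1 , ∣-refl) , refl
  regroup : ∀ a x y M → a * a - (a * x - y * M) ≡ a * (a - x) + y * M
  regroup = solve-∀
  a²-1≡ : + a * + a - 1ℤ ≡ + a * (+ a - x) + y * + M
  a²-1≡ = trans (cong (λ u → + a * + a - u) (sym ax-yM≡1)) (regroup (+ a) x y (+ M))

TraceDiffΓ₀-divisor∣gcd[M,24] : ∀ {M} → .{{NonZero M}} → ∀ e → (∀ x → TraceDiffΓ₀ M x → e ∣ᵤ x) →
                                e ∣ᵤ (+ gcd M 24)
TraceDiffΓ₀-divisor∣gcd[M,24] {M} {{M≢0}} e e∣trace-diffs =
  gcd-greatest e∣M (UnitsSquareToOne⇒∣24 {{M≢0}} {{e≢0}} (TraceDiffΓ₀-divisor⇒UnitsSquareToOne e e∣trace-diffs))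
  where
  e∣M : ℤ.∣ e ∣ ∣ M
  e∣M = e∣trace-diffs (+ M) (M∈TraceDiffΓ₀ M)
  e≢0 : NonZero ℤ.∣ e ∣
  e≢0 = ≢-nonZero (λ e≡0 → ≢-nonZero⁻¹ M (0∣⇒≡0 (subst (_∣ M) e≡0 e∣M)))

↥-/1 : ∀ i → ↥ (i ℚ./ 1) ≡ i
↥-/1 i = begin
  ↥ (i ℚ./ 1)                  ≡⟨ *-identityʳ _ ⟨
  ↥ (i ℚ./ 1) * 1ℤ             ≡⟨ cong (↥ (i ℚ./ 1) *_) (ℤ.gcd-zeroʳ i) ⟨
  ↥ (i ℚ./ 1) * ℤ.gcd i (+ 1)  ≡⟨ ℚ.↥-/ i 1 ⟩
  i                            ∎
  where open ≡-Reasoning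

↧-/1 : ∀ i → ↧ (i ℚ./ 1) ≡ 1ℤ
↧-/1 i = begin
  ↧ (i ℚ./ 1)                  ≡⟨ *-identityʳ _ ⟨
  ↧ (i ℚ./ 1) * 1ℤ             ≡⟨ cong (↧ (i ℚ./ 1) *_) (ℤ.gcd-zeroʳ i) ⟨
  ↧ (i ℚ./ 1) * ℤ.gcd i (+ 1)  ≡⟨ ℚ.↧-/ i 1 ⟩
  1ℤ                           ∎
  where open ≡-Reasoning

/1∈ℤ₍M₎ : ∀ M i → Inℤ₍ M ₎ (i ℚ./ 1)
/1∈ℤ₍M₎ M i = subst (λ n → Coprime n M) (sym (cong ℤ.∣_∣ (↧-/1 i))) (Coprime.1-coprimeTo M)

toℚᵘ-/1 : ∀ i → toℚᵘ (i ℚ./ 1) ℚᵘ.≃ mkℚᵘ i 0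
toℚᵘ-/1 i = *≡* (begin
  ℚᵘ.↥ toℚᵘ (i ℚ./ 1) * 1ℤ   ≡⟨ cong (_* 1ℤ) (ℚ.↥ᵘ-toℚᵘ (i ℚ./ 1)) ⟩
  ↥ (i ℚ./ 1) * 1ℤ           ≡⟨ *-identityʳ _ ⟩
  ↥ (i ℚ./ 1)                ≡⟨ ↥-/1 i ⟩
  i                          ≡⟨ *-identityʳ i ⟨
  i * 1ℤ                     ≡⟨ cong (i *_) (trans (ℚ.↧ᵘ-toℚᵘ (i ℚ./ 1)) (↧-/1 i)) ⟨
  i * ℚᵘ.↧ toℚᵘ (i ℚ./ 1)    ∎)
  where open ≡-Reasoning

toℚᵘ-detℚ : ∀ m → toℚᵘ (detℚ (toℚMat m)) ℚᵘ.≃ mkℚᵘ (detℤ m) 0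
toℚᵘ-detℚ (mat a b c d) = begin
  toℚᵘ (A ℚ.* D ℚ.- B ℚ.* C)                          ≈⟨ ℚ.toℚᵘ-homo-+ (A ℚ.* D) (ℚ.- (B ℚ.* C)) ⟩
  toℚᵘ (A ℚ.* D) ℚᵘ.+ toℚᵘ (ℚ.- (B ℚ.* C))           ≈⟨ ℚᵘ.+-cong (ℚ.toℚᵘ-homo-* A D)
                                                          (ℚᵘ.≃-trans (ℚ.toℚᵘ-homo‿- (B ℚ.* C)) (ℚᵘ.-‿cong (ℚ.toℚᵘ-homo-* B C))) ⟩
  toℚᵘ A ℚᵘ.* toℚᵘ D ℚᵘ.+ ℚᵘ.- (toℚᵘ B ℚᵘ.* toℚᵘ C)  ≈⟨ ℚᵘ.+-cong (ℚᵘ.*-cong (toℚᵘ-/1 a) (toℚᵘ-/1 d))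
                                                          (ℚᵘ.-‿cong (ℚᵘ.*-cong (toℚᵘ-/1 b) (toℚᵘ-/1 c))) ⟩
  mkℚᵘ a 0 ℚᵘ.* mkℚᵘ d 0 ℚᵘ.+ ℚᵘ.- (mkℚᵘ b 0 ℚᵘ.* mkℚᵘ c 0)  ≈⟨ *≡* (normalise a b c d) ⟩
  mkℚᵘ (a * d - b * c) 0                              ∎
  where
  open ℚᵘ.≃-Reasoning
  A B C D : ℚ.ℚ
  A = a ℚ./ 1
  B = b ℚ./ 1
  C = c ℚ./ 1
  D = d ℚ./ 1
  normalise : ∀ a b c d → (a * d * 1ℤ + ℤ.- (b * c) * 1ℤ) * 1ℤ ≡ (a * d - b * c) * 1ℤ
  normalise = solve-∀

cross-multiply : ∀ {p i} q j → toℚᵘ p ℚᵘ.≃ mkℚᵘ i 0 → p ℚ.* q ≡ j ℚ./ 1 → i * ↥ q ≡ j * ↧ q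
cross-multiply {p} {i} q@(mkℚ _ q-1 _) j p≃i pq≡j with
  ℚᵘ.≃-trans (ℚᵘ.*-cong (ℚᵘ.≃-sym p≃i) ℚᵘ.≃-refl)
    (ℚᵘ.≃-trans (ℚᵘ.≃-sym (ℚ.toℚᵘ-homo-* p q)) (ℚᵘ.≃-trans (ℚ.toℚᵘ-cong pq≡j) (toℚᵘ-/1 j)))
... | *≡* iq≡j = trans (sym (*-identityʳ _)) (trans iq≡j (cong (λ k → j * + ℕ.suc k) (ℕ.+-identityʳ q-1)))

G₀∩M₂ℤ⇒coprime-det : ∀ {M} m → InG₀ M (toℚMat m) → Coprime ℤ.∣ detℤ m ∣ M
G₀∩M₂ℤ⇒coprime-det m (_ , _ , _ , _ , (_ , r , r∈ℤ₍M₎ , det*r≡1) , _) {k} (k∣det , k∣M) =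
  r∈ℤ₍M₎ (∣⇒∣ᵤ (subst ((+ k) ∣ℤ_) det*↥r≡↧r (ℤ∣.∣m⇒∣m*n (↥ r) (∣ᵤ⇒∣ {+ k} {detℤ m} k∣det))) , k∣M)
  where
  det*↥r≡↧r : detℤ m * ↥ r ≡ ↧ r
  det*↥r≡↧r = trans (cross-multiply r 1ℤ (toℚᵘ-detℚ m) det*r≡1) (*-identityˡ (↧ r))

G₀∩M₂ℤ⇒M∣c : ∀ {M} m → InG₀ M (toℚMat m) → (+ M) ∣ᵤ c m
G₀∩M₂ℤ⇒M∣c {M} m (_ , _ , _ , _ , _ , x , x∈ℤ₍M₎ , c≡Mx) =
  coprime-divisor (Coprime.sym x∈ℤ₍M₎) (subst (M ∣_) (abs-* (↧ x) (c m)) (∣⇒∣ᵤ M∣↧x*c))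
  where
  M*↥x≡↧x*c : + M * ↥ x ≡ ↧ x * c m
  M*↥x≡↧x*c = trans (cross-multiply x (c m) (toℚᵘ-/1 (+ M)) (sym c≡Mx)) (*-comm (c m) (↧ x))
  M∣↧x*c : (+ M) ∣ℤ (↧ x * c m)
  M∣↧x*c = subst ((+ M) ∣ℤ_) M*↥x≡↧x*c (ℤ∣.∣m⇒∣m*n (↥ x) ℤ∣.∣-refl)

even-or-odd : ∀ z → (+ 2) ∣ℤ z ⊎ (+ 2) ∣ℤ (z - 1ℤ)
even-or-odd z with z %ℕ 2 | n%ℕd<d z 2 | a≡a%ℕn+[a/ℕn]*n z 2
... | 0 | _ | z≡2q = inj₁ (ℤ∣.divides (z /ℕ 2) (trans z≡2q (+-identityˡ _)))
... | 1 | _ | z≡1+2q = inj₂ (ℤ∣.divides (z /ℕ 2) (trans (cong (_- 1ℤ) z≡1+2q) (1+u-1≡u (z /ℕ 2 * + 2))))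
  where
  1+u-1≡u : ∀ u → (1ℤ + u) - 1ℤ ≡ u
  1+u-1≡u = solve-∀
... | ℕ.suc (ℕ.suc _) | ℕ.s≤s (ℕ.s≤s ()) | _

-- ad = det + bc is odd, so a and d are both odd.
odd-det∧even-c⇒even-a-d : ∀ m → ¬ (+ 2) ∣ℤ detℤ m → (+ 2) ∣ℤ c m → (+ 2) ∣ℤ (a m - d m)
odd-det∧even-c⇒even-a-d (mat a b c d) 2∤det 2∣c with even-or-odd a | even-or-odd d
... | inj₁ 2∣a | _ = contradiction (ℤ∣.∣m∣n⇒∣m-n (ℤ∣.∣m⇒∣m*n d 2∣a) (ℤ∣.∣n⇒∣m*n b 2∣c)) 2∤det
... | inj₂ _ | inj₁ 2∣d = contradiction (ℤ∣.∣m∣n⇒∣m-n (ℤ∣.∣n⇒∣m*n a 2∣d) (ℤ∣.∣n⇒∣m*n b 2∣c)) 2∤det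
... | inj₂ 2∣a-1 | inj₂ 2∣d-1 = subst ((+ 2) ∣ℤ_) (shift a d) (ℤ∣.∣m∣n⇒∣m-n 2∣a-1 2∣d-1)
  where
  shift : ∀ a d → (a - 1ℤ) - (d - 1ℤ) ≡ a - d
  shift = solve-∀

G₀∩M₂ℤ⇒2∣a-d : ∀ {M} m → 2 ∣ M → InG₀ M (toℚMat m) → (+ 2) ∣ℤ (a m - d m)
G₀∩M₂ℤ⇒2∣a-d m 2∣M m∈G₀ = odd-det∧even-c⇒even-a-d m
  (λ 2∣det → contradiction (G₀∩M₂ℤ⇒coprime-det m m∈G₀ (∣⇒∣ᵤ 2∣det , 2∣M)) λ ())
  (∣ᵤ⇒∣ (∣-trans 2∣M (G₀∩M₂ℤ⇒M∣c m m∈G₀)))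

diagonal∈G₀ : ∀ M u v → Inℤ₍ M ₎ˣ (detℚ (toℚMat (mat u 0ℤ 0ℤ v))) → InG₀ M (toℚMat (mat u 0ℤ 0ℤ v))
diagonal∈G₀ M u v det-unit =
  /1∈ℤ₍M₎ M u , /1∈ℤ₍M₎ M 0ℤ , /1∈ℤ₍M₎ M 0ℤ , /1∈ℤ₍M₎ M v , det-unit ,
  ℚ.0ℚ , /1∈ℤ₍M₎ M 0ℤ , sym (ℚ.*-zeroʳ (+ M ℚ./ 1))

IsGCDOf-∋ : ∀ {P g} → (∀ x → P x → (+ g) ∣ᵤ x) → P (+ g) → IsGCDOf P g
IsGCDOf-∋ g∣P g∈P = g∣P , λ e e∣P → e∣P _ g∈P

IsGCDOf-TraceDiffΓ₀ : ∀ M → .{{NonZero M}} → IsGCDOf (TraceDiffΓ₀ M) (gcd M 24)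
IsGCDOf-TraceDiffΓ₀ M = g∣trace-diffs , TraceDiffΓ₀-divisor∣gcd[M,24]
  where
  g∣trace-diffs : ∀ x → TraceDiffΓ₀ M x → (+ gcd M 24) ∣ᵤ x
  g∣trace-diffs _ (m , m∈Γ₀ , refl) = ∣⇒∣ᵤ (Γ₀⇒gcd[M,24]∣a-d m m∈Γ₀)

IsGCDOf-TraceDiffG₀ℤ : ∀ M → IsGCDOf (TraceDiffG₀ℤ M) (gcd M 2)
IsGCDOf-TraceDiffG₀ℤ M with 2 ∣? M
... | yes 2∣M = subst (IsGCDOf (TraceDiffG₀ℤ M)) (sym gcd[M,2]≡2) (IsGCDOf-∋ 2∣trace-diffs 2∈trace-diffs)
  where
  gcd[M,2]≡2 : gcd M 2 ≡ 2
  gcd[M,2]≡2 = ∣-antisym (gcd[m,n]∣n M 2) (gcd-greatest 2∣M ∣-refl)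
  2∣trace-diffs : ∀ x → TraceDiffG₀ℤ M x → (+ 2) ∣ᵤ x
  2∣trace-diffs _ (m , m∈G₀ , refl) = ∣⇒∣ᵤ (G₀∩M₂ℤ⇒2∣a-d m 2∣M m∈G₀)
  2∈trace-diffs : TraceDiffG₀ℤ M (+ 2)
  2∈trace-diffs = mat 1ℤ 0ℤ 0ℤ ℤ.-1ℤ
    , diagonal∈G₀ M 1ℤ ℤ.-1ℤ (/1∈ℤ₍M₎ M ℤ.-1ℤ , ℚ.- ℚ.1ℚ , /1∈ℤ₍M₎ M ℤ.-1ℤ , refl) , refl
... | no 2∤M = subst (IsGCDOf (TraceDiffG₀ℤ M)) (sym gcd[M,2]≡1) (IsGCDOf-∋ (λ x _ → 1∣ ℤ.∣ x ∣) 1∈trace-diffs)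
  where
  2⊥M : Coprime 2 M
  2⊥M = prime∤⇒coprime prime[2] 2∤M
  gcd[M,2]≡1 : gcd M 2 ≡ 1
  gcd[M,2]≡1 = Coprime.coprime⇒gcd≡1 (Coprime.sym 2⊥M)
  1∈trace-diffs : TraceDiffG₀ℤ M 1ℤ
  1∈trace-diffs = mat (+ 2) 0ℤ 0ℤ 1ℤ
    , diagonal∈G₀ M (+ 2) 1ℤ (/1∈ℤ₍M₎ M (+ 2) , + 1 ℚ./ 2 , 2⊥M , refl) , refl

lemma5p7 : (M : ℕ) → 1 ≤ M →
    IsGCDOf (TraceDiffΓ₀ M) (gcd M 24)
    × IsGCDOf (TraceDiffG₀ℤ M) (gcd M 2)
    × ((m : Mat2 ℤ) → InΓ₀ M m ⇔ InΓ₀' (gcd M 24) M m)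
lemma5p7 M 1≤M =
  IsGCDOf-TraceDiffΓ₀ M , IsGCDOf-TraceDiffG₀ℤ M ,
  λ m → mk⇔ (λ m∈Γ₀ → m∈Γ₀ , ∣⇒∣ᵤ (Γ₀⇒gcd[M,24]∣a-d m m∈Γ₀)) proj₁
  where instance _ = >-nonZero 1≤M
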